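{- Let $(a_1,\dots,a_n)$ and $(b_1,\dots,b_k)$ be non-increasing sequences of positive integers with $(a_1,\dots,a_n)\succ(b_1,\dots,b_k)$. (i) If $a_1!a_2!\cdots a_n! + a_1a_2\cdots a_n = b_1!b_2!\cdots b_k! + b_1b_2\cdots b_k$, then $n=k$ and $a_i=b_i$ for all $i$. (ii) If $a_1!a_2!\cdots a_n! - a_1a_2\cdots a_n = b_1!b_2!\cdots b_k! - b_1b_2\cdots b_k$, then either (a) $n=k$ and $a_i=b_i$ for all $i$, or (b) all $a_i$ and all $b_i$ lie in $\{1,2\}$.
   Context: Majorization: for finite non-increasing sequences of positive integers $(a_1,\dots,a_n)$ and $(b_1,\dots,b_k)$, write $(a_1,\dots,a_n)\succ(b_1,\dots,b_k)$ if all of the following hold: (1) $n\le k$; (2) for every $i\le n$, $a_1+\dots+a_i\ge b_1+\dots+b_i$; (3) $a_1+\dots+a_n\ge b_1+\dots+b_k$. -}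

module Defs where

open import Data.Nat using (ℕ; _≤_; _≥_; _<_)
open import Data.Nat.Base using (_!)
open import Data.List using (List; length; take; map)
open import Data.Nat.ListAction using (sum; product)
open import Data.List.Relation.Unary.All using (All)
open import Data.List.Relation.Unary.Linked using (Linked)
open import Data.Product using (_×_)

NonIncreasing : List ℕ → Set
NonIncreasing = Linked _≥_

Positive : List ℕ → Set
Positive = All (0 <_)

_≻_ : List ℕ → List ℕ → Set
as ≻ bs = (length as ≤ length bs)
        × ((i : ℕ) → i ≤ length as → sum (take i as) ≥ sum (take i bs))
        × (sum as ≥ sum bs)

factProd : List ℕ → ℕ
factProd xs = product (map (λ x → x !) xs)

module Submission where

-- Read a sequence as a Young diagram whose i-th row holds the cells 1, 2, …, aᵢ, so that Π aᵢ! is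
-- the product of all cells. When bs is non-increasing, as ≻ bs says exactly that for every t the
-- diagram of as has at least as many cells ≥ t as that of bs; after sorting, the cells of bs are
-- then dominated one by one by those of as. Hence Π w(cell) is larger for as whenever the weight w
-- is non-decreasing and at least 1, and for w = id it is strictly larger unless as = bs.
-- Write A = Π aᵢ!, P = Π aᵢ, C = Π (aᵢ − 1)!, so A = P · C, and B, Q, D likewise for bs. The
-- weights distributing (aᵢ − 1)! and aᵢ · aᵢ! over the cells give D ≤ C and Q · B ≤ P · A.
-- (i) If as ≠ bs then B < A, and A + P = B + Q would give Q · B > P · A.
-- (ii) If as ≠ bs then A − P = B − Q gives (P − Q) · C ≤ P · C − Q · D = P − Q with P > Q, so
-- C = D = 1, which means every entry is at most 2.

open import Defs
open import Data.Nat using (ℕ; _≤_)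
open import Data.Integer using (ℤ; +_; _-_)
open import Data.List using (List)
open import Data.Nat.ListAction using (product)
open import Data.List.Relation.Unary.All using (All)
open import Data.Product using (_×_)
open import Data.Sum using (_⊎_)
open import Relation.Binary.PropositionalEquality using (_≡_)

open import Data.Nat using (zero; suc; pred; _+_; _*_; _∸_; _<_; _≤?_; z≤n; s≤s; s≤s⁻¹; >-nonZero)
open import Data.Nat.Base using (_!)
open import Data.Nat.Properties
open import Data.Nat.ListAction using (sum)
open import Data.Nat.ListAction.Properties using (sum-++; product-++; product-↭)
open import Data.List using ([]; _∷_; _++_; take; drop; length; map; filter; concatMap; applyDownFrom)
open import Data.List.Properties using (take-all; take++drop≡id; length-++; filter-++; filter-accept; filter-reject; filter-none; map-++; map-cong)
open import Data.List.Relation.Binary.Permutation.Propositional using (_↭_; ↭-sym)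
open import Data.List.Relation.Binary.Permutation.Propositional.Properties using (map⁺; filter-↭; ↭-length; All-resp-↭)
open import Data.List.Relation.Unary.All using ([]; _∷_)
import Data.List.Relation.Unary.All as All
open import Data.List.Relation.Unary.All.Properties using (applyDownFrom⁺₁; ++⁺)
import Data.List.Relation.Unary.Linked as Linked
open import Data.List.Relation.Unary.Linked.Properties using (Linked⇒All)
import Relation.Binary.Construct.Flip.EqAndOrd as Flip
open import Data.List.Sort (Flip.decTotalOrder ≤-decTotalOrder) using (sort; sort-↭; sort-↗)
open import Data.Product using (_,_; ∃-syntax)
open import Data.Sum using (inj₁; inj₂)
open import Function using (id; const)
open import Relation.Nullary using (¬_; yes; no; contradiction)
open import Relation.Binary.PropositionalEquality using (refl; sym; trans; cong; cong₂; subst; subst₂; module ≡-Reasoning)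
open import Data.Nat.Tactic.RingSolver using (solve-∀)
import Data.Integer as ℤ
import Data.Integer.Properties as ℤ
open import Data.Integer.Tactic.RingSolver renaming (solve-∀ to ℤ-solve-∀)

*-interchange : ∀ a b c d → (a * b) * (c * d) ≡ (a * c) * (b * d)
*-interchange = solve-∀

Π : (ℕ → ℕ) → List ℕ → ℕ
Π w xs = product (map w xs)

Π-↭ : ∀ w {xs ys} → xs ↭ ys → Π w xs ≡ Π w ys
Π-↭ w p = product-↭ (map⁺ w p)

Π-++ : ∀ w xs ys → Π w (xs ++ ys) ≡ Π w xs * Π w ys
Π-++ w xs ys = trans (cong product (map-++ w xs ys)) (product-++ (map w xs) (map w ys))

Π-* : ∀ f g xs → Π (λ x → f x * g x) xs ≡ Π f xs * Π g xs
Π-* f g [] = refl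
Π-* f g (x ∷ xs) = trans (cong (f x * g x *_) (Π-* f g xs)) (*-interchange (f x) (g x) (Π f xs) (Π g xs))

Π-positive : ∀ {w} → (∀ {x} → 1 ≤ x → 1 ≤ w x) → ∀ {xs} → All (1 ≤_) xs → 1 ≤ Π w xs
Π-positive w≥1 [] = ≤-refl
Π-positive w≥1 (p ∷ ps) = *-mono-≤ (w≥1 p) (Π-positive w≥1 ps)

Π-mono-≤ : ∀ {v w} → (∀ {x} → 1 ≤ x → v x ≤ w x) → ∀ {xs} → All (1 ≤_) xs → Π v xs ≤ Π w xs
Π-mono-≤ v≤w [] = ≤-refl
Π-mono-≤ v≤w (p ∷ ps) = *-mono-≤ (v≤w p) (Π-mono-≤ v≤w ps)

Π-const-1 : ∀ xs → Π (const 1) xs ≡ 1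
Π-const-1 [] = refl
Π-const-1 (x ∷ xs) = trans (+-identityʳ _) (Π-const-1 xs)

-- Young diagrams and cell counts

row : ℕ → List ℕ
row = applyDownFrom suc

cells : List ℕ → List ℕ
cells = concatMap row

Π-cells : ∀ w xs → Π w (cells xs) ≡ Π (λ x → Π w (row x)) xs
Π-cells w [] = refl
Π-cells w (x ∷ xs) = trans (Π-++ w (row x) (cells xs)) (cong (Π w (row x) *_) (Π-cells w xs))

cells-positive : ∀ xs → All (1 ≤_) (cells xs)
cells-positive [] = []
cells-positive (x ∷ xs) = ++⁺ (applyDownFrom⁺₁ suc x (λ _ → s≤s z≤n)) (cells-positive xs)

count≥ : ℕ → List ℕ → ℕ
count≥ t xs = length (filter (t ≤?_) xs)

count≥-↭ : ∀ t {xs ys} → xs ↭ ys → count≥ t xs ≡ count≥ t ys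
count≥-↭ t p = ↭-length (filter-↭ (t ≤?_) p)

count≥-++ : ∀ t xs ys → count≥ t (xs ++ ys) ≡ count≥ t xs + count≥ t ys
count≥-++ t xs ys = trans (cong length (filter-++ (t ≤?_) xs ys)) (length-++ (filter (t ≤?_) xs))

count≥-accept : ∀ t {y} ys → t ≤ y → count≥ t (y ∷ ys) ≡ suc (count≥ t ys)
count≥-accept t ys t≤y = cong length (filter-accept (t ≤?_) t≤y)

count≥-reject : ∀ t {y} ys → y < t → count≥ t (y ∷ ys) ≡ count≥ t ys
count≥-reject t ys y<t = cong length (filter-reject (t ≤?_) (<⇒≱ y<t))

count≥-row : ∀ t x → count≥ t (row x) ≡ x ∸ pred t
count≥-row t zero = sym (0∸n≡0 (pred t))
count≥-row t (suc x) with t ≤? suc x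
... | yes t≤1+x = begin
  count≥ t (suc x ∷ row x)  ≡⟨ count≥-accept t (row x) t≤1+x ⟩
  suc (count≥ t (row x))    ≡⟨ cong suc (count≥-row t x) ⟩
  suc (x ∸ pred t)          ≡⟨ +-∸-assoc 1 (pred-mono-≤ t≤1+x) ⟨
  suc x ∸ pred t            ∎
  where open ≡-Reasoning
... | no t≰1+x = begin
  count≥ t (suc x ∷ row x)  ≡⟨ count≥-reject t (row x) (≰⇒> t≰1+x) ⟩
  count≥ t (row x)          ≡⟨ count≥-row t x ⟩
  x ∸ pred t                ≡⟨ m≤n⇒m∸n≡0 (≤-trans (n≤1+n x) 1+x≤pred-t) ⟩
  0                         ≡⟨ m≤n⇒m∸n≡0 1+x≤pred-t ⟨
  suc x ∸ pred t            ∎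
  where
  open ≡-Reasoning
  1+x≤pred-t : suc x ≤ pred t
  1+x≤pred-t = pred-mono-≤ (≰⇒> t≰1+x)

excess : ℕ → List ℕ → ℕ
excess t xs = sum (map (_∸ t) xs)

count≥-cells : ∀ t xs → count≥ t (cells xs) ≡ excess (pred t) xs
count≥-cells t [] = refl
count≥-cells t (x ∷ xs) =
  trans (count≥-++ t (row x) (cells xs)) (cong₂ _+_ (count≥-row t x) (count≥-cells t xs))

bounded-by-head : ∀ {t x xs} → x ≤ t → NonIncreasing (x ∷ xs) → All (_≤ t) (x ∷ xs)
bounded-by-head = Linked⇒All (λ y≤x z≤y → ≤-trans z≤y y≤x)

excess-bounded : ∀ {t xs} → All (_≤ t) xs → excess t xs ≡ 0
excess-bounded [] = refl
excess-bounded (x≤t ∷ xs≤t) = cong₂ _+_ (m≤n⇒m∸n≡0 x≤t) (excess-bounded xs≤t)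

-- Majorization as domination of cell counts

sum-take≤excess : ∀ t j xs → sum (take j xs) ≤ excess t xs + j * t
sum-take≤excess t zero xs = z≤n
sum-take≤excess t (suc j) [] = z≤n
sum-take≤excess t (suc j) (x ∷ xs) = begin
  x + sum (take j xs)                      ≤⟨ +-mono-≤ (m≤n+m∸n x t) (sum-take≤excess t j xs) ⟩
  (t + (x ∸ t)) + (excess t xs + j * t)    ≡⟨ shuffle t (x ∸ t) (excess t xs) (j * t) ⟩
  ((x ∸ t) + excess t xs) + (t + j * t)    ∎
  where
  open ≤-Reasoning
  shuffle : ∀ a b c d → (a + b) + (c + d) ≡ (b + c) + (a + d)
  shuffle = solve-∀

-- j is the number of entries exceeding t.
excess≤sum-take : ∀ t xs → NonIncreasing xs → ∃[ j ] excess t xs + j * t ≤ sum (take j xs)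
excess≤sum-take t [] _ = 0 , z≤n
excess≤sum-take t (x ∷ xs) nxs with x ≤? t
... | yes x≤t = 0 , ≤-reflexive (trans (+-identityʳ _) (excess-bounded (bounded-by-head x≤t nxs)))
... | no x≰t with excess≤sum-take t xs (Linked.tail nxs)
...   | j , h = suc j , (begin
  ((x ∸ t) + excess t xs) + (t + j * t)    ≡⟨ shuffle (x ∸ t) (excess t xs) t (j * t) ⟩
  ((x ∸ t) + t) + (excess t xs + j * t)    ≡⟨ cong (_+ (excess t xs + j * t)) (m∸n+n≡m (<⇒≤ (≰⇒> x≰t))) ⟩
  x + (excess t xs + j * t)                ≤⟨ +-monoʳ-≤ x h ⟩
  x + sum (take j xs)                      ∎)
  where
  open ≤-Reasoning
  shuffle : ∀ a b c d → (a + b) + (c + d) ≡ (a + c) + (b + d)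
  shuffle = solve-∀

sum-take≤sum : ∀ j xs → sum (take j xs) ≤ sum xs
sum-take≤sum j xs = begin
  sum (take j xs)                        ≤⟨ m≤m+n _ _ ⟩
  sum (take j xs) + sum (drop j xs)      ≡⟨ sum-++ (take j xs) (drop j xs) ⟨
  sum (take j xs ++ drop j xs)           ≡⟨ cong sum (take++drop≡id j xs) ⟩
  sum xs                                 ∎
  where open ≤-Reasoning

≻⇒prefix-sum≤ : ∀ {as bs} → as ≻ bs → ∀ j → sum (take j bs) ≤ sum (take j as)
≻⇒prefix-sum≤ {as} {bs} (_ , prefix , total) j with j ≤? length as
... | yes j≤n = prefix j j≤n
... | no j≰n = begin
  sum (take j bs)  ≤⟨ sum-take≤sum j bs ⟩
  sum bs           ≤⟨ total ⟩
  sum as           ≡⟨ cong sum (take-all j as (<⇒≤ (≰⇒> j≰n))) ⟨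
  sum (take j as)  ∎
  where open ≤-Reasoning

≻⇒excess≤ : ∀ {as bs} → NonIncreasing bs → as ≻ bs → ∀ t → excess t bs ≤ excess t as
≻⇒excess≤ {as} {bs} nbs maj t with excess≤sum-take t bs nbs
... | j , h = +-cancelʳ-≤ (j * t) _ _ (begin
  excess t bs + j * t  ≤⟨ h ⟩
  sum (take j bs)      ≤⟨ ≻⇒prefix-sum≤ maj j ⟩
  sum (take j as)      ≤⟨ sum-take≤excess t j as ⟩
  excess t as + j * t  ∎)
  where open ≤-Reasoning

Dominates : List ℕ → List ℕ → Set
Dominates xs ys = ∀ t → count≥ t ys ≤ count≥ t xs

Dominates-↭ : ∀ {xs xs′ ys ys′} → xs ↭ xs′ → ys ↭ ys′ → Dominates xs ys → Dominates xs′ ys′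
Dominates-↭ p q D t = subst₂ _≤_ (count≥-↭ t q) (count≥-↭ t p) (D t)

≻⇒cells-dominate : ∀ {as bs} → NonIncreasing bs → as ≻ bs → Dominates (cells as) (cells bs)
≻⇒cells-dominate {as} {bs} nbs maj t =
  subst₂ _≤_ (sym (count≥-cells t bs)) (sym (count≥-cells t as)) (≻⇒excess≤ nbs maj (pred t))

sortedCells : List ℕ → List ℕ
sortedCells xs = sort (cells xs)

sortedCells-↭ : ∀ xs → sortedCells xs ↭ cells xs
sortedCells-↭ xs = sort-↭ (cells xs)

sortedCells-sorted : ∀ xs → NonIncreasing (sortedCells xs)
sortedCells-sorted xs = sort-↗ (cells xs)

sortedCells-positive : ∀ xs → All (1 ≤_) (sortedCells xs)
sortedCells-positive xs = All-resp-↭ (↭-sym (sortedCells-↭ xs)) (cells-positive xs)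

≻⇒sortedCells-dominate : ∀ {as bs} → NonIncreasing bs → as ≻ bs → Dominates (sortedCells as) (sortedCells bs)
≻⇒sortedCells-dominate {as} {bs} nbs maj =
  Dominates-↭ (↭-sym (sortedCells-↭ as)) (↭-sym (sortedCells-↭ bs)) (≻⇒cells-dominate nbs maj)

count≥-below-head : ∀ {t y ys} → NonIncreasing (y ∷ ys) → y < t → count≥ t (y ∷ ys) ≡ 0
count≥-below-head {t} nys y<t =
  cong length (filter-none (t ≤?_)
    (All.map (λ z≤y → <⇒≱ (≤-<-trans z≤y y<t)) (bounded-by-head ≤-refl nys)))

Dominates-[] : ∀ {y ys} → ¬ Dominates [] (y ∷ ys)
Dominates-[] {y} {ys} D with () ← subst (_≤ 0) (count≥-accept y ys ≤-refl) (D y)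

Dominates-head : ∀ {x xs y ys} → NonIncreasing (x ∷ xs) → Dominates (x ∷ xs) (y ∷ ys) → y ≤ x
Dominates-head {x} {xs} {y} {ys} nxs D with y ≤? x
... | yes y≤x = y≤x
... | no y≰x with () ← subst₂ _≤_ (count≥-accept y ys ≤-refl) (count≥-below-head nxs (≰⇒> y≰x)) (D y)

Dominates-tail : ∀ {x xs y ys} → NonIncreasing (y ∷ ys) → y ≤ x →
                 Dominates (x ∷ xs) (y ∷ ys) → Dominates xs ys
Dominates-tail {x} {xs} {y} {ys} nys y≤x D t with t ≤? y
... | yes t≤y = s≤s⁻¹ (subst₂ _≤_ (count≥-accept t ys t≤y) (count≥-accept t xs (≤-trans t≤y y≤x)) (D t))
... | no t≰y = begin
  count≥ t ys        ≡⟨ count≥-reject t ys y<t ⟨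
  count≥ t (y ∷ ys)  ≡⟨ count≥-below-head nys y<t ⟩
  0                  ≤⟨ z≤n ⟩
  count≥ t xs        ∎
  where
  open ≤-Reasoning
  y<t : y < t
  y<t = ≰⇒> t≰y

-- The weight u / v is kept as a fraction so that everything stays in ℕ; the hypotheses say it is
-- non-decreasing and at least 1 on positive entries.
Π-ratio-mono : ∀ (u v : ℕ → ℕ) → (∀ {x y} → y ≤ x → u y * v x ≤ u x * v y) → (∀ {x} → 1 ≤ x → v x ≤ u x) →
               ∀ {xs ys} → NonIncreasing xs → NonIncreasing ys → All (1 ≤_) xs → Dominates xs ys →
               Π u ys * Π v xs ≤ Π u xs * Π v ys
Π-ratio-mono u v ratio-mono v≤u {xs} {[]} _ _ xs≥1 _ = begin
  1 * Π v xs  ≡⟨ *-identityˡ _ ⟩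
  Π v xs      ≤⟨ Π-mono-≤ v≤u xs≥1 ⟩
  Π u xs      ≡⟨ *-identityʳ _ ⟨
  Π u xs * 1  ∎
  where open ≤-Reasoning
Π-ratio-mono u v ratio-mono v≤u {[]} {y ∷ ys} _ _ _ D = contradiction D Dominates-[]
Π-ratio-mono u v ratio-mono v≤u {x ∷ xs} {y ∷ ys} nxs nys (_ ∷ xs≥1) D = begin
  (u y * Π u ys) * (v x * Π v xs)  ≡⟨ *-interchange (u y) (Π u ys) (v x) (Π v xs) ⟩
  (u y * v x) * (Π u ys * Π v xs)  ≤⟨ *-mono-≤ (ratio-mono y≤x) tails ⟩
  (u x * v y) * (Π u xs * Π v ys)  ≡⟨ *-interchange (u x) (Π u xs) (v y) (Π v ys) ⟨
  (u x * Π u xs) * (v y * Π v ys)  ∎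
  where
  open ≤-Reasoning
  y≤x : y ≤ x
  y≤x = Dominates-head nxs D
  tails : Π u ys * Π v xs ≤ Π u xs * Π v ys
  tails = Π-ratio-mono u v ratio-mono v≤u (Linked.tail nxs) (Linked.tail nys) xs≥1 (Dominates-tail nys y≤x D)

Π-mono-dominates : ∀ (w : ℕ → ℕ) → (∀ {x y} → y ≤ x → w y ≤ w x) → (∀ {x} → 1 ≤ x → 1 ≤ w x) →
                   ∀ {xs ys} → NonIncreasing xs → NonIncreasing ys → All (1 ≤_) xs → Dominates xs ys →
                   Π w ys ≤ Π w xs
Π-mono-dominates w w-mono w≥1 {xs} {ys} nxs nys xs≥1 D = subst₂ _≤_ (drop-1 ys xs) (drop-1 xs ys)
  (Π-ratio-mono w (const 1) (λ y≤x → *-monoˡ-≤ 1 (w-mono y≤x)) w≥1 nxs nys xs≥1 D)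
  where
  drop-1 : ∀ zs zs′ → Π w zs * Π (const 1) zs′ ≡ Π w zs
  drop-1 zs zs′ = trans (cong (Π w zs *_) (Π-const-1 zs′)) (*-identityʳ _)

count≥-positive⇒≤head : ∀ {t x xs} → NonIncreasing (x ∷ xs) → 0 < count≥ t (x ∷ xs) → t ≤ x
count≥-positive⇒≤head {t} {x} nxs t∈xs with t ≤? x
... | yes t≤x = t≤x
... | no t≰x with () ← subst (0 <_) (count≥-below-head nxs (≰⇒> t≰x)) t∈xs

count≥-zero⇒head< : ∀ {t y} ys → count≥ t (y ∷ ys) ≡ 0 → y < t
count≥-zero⇒head< {t} {y} ys t∉ys with t ≤? y
... | yes t≤y with () ← trans (sym (count≥-accept t ys t≤y)) t∉ys
... | no t≰y = ≰⇒> t≰y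

Π-id-dominates-strict : ∀ {xs ys t} → NonIncreasing xs → NonIncreasing ys → All (1 ≤_) xs → Dominates xs ys →
                        2 ≤ t → 0 < count≥ t xs → count≥ t ys ≡ 0 → Π id ys < Π id xs
Π-id-dominates-strict {[]} _ _ _ _ _ () _
Π-id-dominates-strict {x ∷ xs} {[]} nxs _ (_ ∷ xs≥1) _ 2≤t t∈xs _ =
  *-mono-≤ (≤-trans 2≤t (count≥-positive⇒≤head nxs t∈xs)) (Π-positive id xs≥1)
Π-id-dominates-strict {x ∷ xs} {y ∷ ys} {t} nxs nys (_ ∷ xs≥1) D _ t∈xs t∉ys = begin-strict
  y * Π id ys  ≤⟨ *-monoʳ-≤ y tails ⟩
  y * Π id xs  <⟨ *-monoˡ-< (Π id xs) {{>-nonZero (Π-positive id xs≥1)}} y<x ⟩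
  x * Π id xs  ∎
  where
  open ≤-Reasoning
  y<x : y < x
  y<x = <-≤-trans (count≥-zero⇒head< {t} ys t∉ys) (count≥-positive⇒≤head nxs t∈xs)
  tails : Π id ys ≤ Π id xs
  tails = Π-mono-dominates id id id (Linked.tail nxs) (Linked.tail nys) xs≥1 (Dominates-tail nys (<⇒≤ y<x) D)

Π-id-row : ∀ x → Π id (row x) ≡ x !
Π-id-row zero = refl
Π-id-row (suc x) = cong (suc x *_) (Π-id-row x)

factProd≡Π-cells : ∀ xs → factProd xs ≡ Π id (cells xs)
factProd≡Π-cells xs = sym (trans (Π-cells id xs) (cong product (map-cong Π-id-row xs)))

-- (x ∸ 1)! = 1 · 1 · 2 ⋯ (x − 1) spreads over the cells 1, 2, …, x of a row.
pred⁺ : ℕ → ℕ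
pred⁺ zero = 1
pred⁺ (suc zero) = 1
pred⁺ (suc (suc n)) = suc n

Π-pred⁺-row : ∀ x → Π pred⁺ (row x) ≡ (x ∸ 1) !
Π-pred⁺-row zero = refl
Π-pred⁺-row (suc zero) = refl
Π-pred⁺-row (suc (suc x)) = cong (suc x *_) (Π-pred⁺-row (suc x))

factPredProd : List ℕ → ℕ
factPredProd = Π (λ x → (x ∸ 1) !)

factPredProd≡Π-cells : ∀ xs → factPredProd xs ≡ Π pred⁺ (cells xs)
factPredProd≡Π-cells xs = sym (trans (Π-cells pred⁺ xs) (cong product (map-cong Π-pred⁺-row xs)))

factProd≡product*factPredProd : ∀ {xs} → Positive xs → factProd xs ≡ product xs * factPredProd xs
factProd≡product*factPredProd [] = refl
factProd≡product*factPredProd {suc x ∷ xs} (_ ∷ pxs) = begin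
  (suc x * x !) * factProd xs                         ≡⟨ cong ((suc x * x !) *_) (factProd≡product*factPredProd pxs) ⟩
  (suc x * x !) * (product xs * factPredProd xs)      ≡⟨ *-interchange (suc x) (x !) (product xs) (factPredProd xs) ⟩
  (suc x * product xs) * (x ! * factPredProd xs)      ∎
  where open ≡-Reasoning

1≤factPredProd : ∀ xs → 1 ≤ factPredProd xs
1≤factPredProd [] = ≤-refl
1≤factPredProd (x ∷ xs) = *-mono-≤ (1≤n! (x ∸ 1)) (1≤factPredProd xs)

1≤pred⁺ : ∀ x → 1 ≤ pred⁺ x
1≤pred⁺ zero = ≤-refl
1≤pred⁺ (suc zero) = ≤-refl
1≤pred⁺ (suc (suc n)) = s≤s z≤n

pred⁺-mono : ∀ {x y} → y ≤ x → pred⁺ y ≤ pred⁺ x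
pred⁺-mono {x} {zero} _ = 1≤pred⁺ x
pred⁺-mono {x} {suc zero} _ = 1≤pred⁺ x
pred⁺-mono {suc (suc x)} {suc (suc y)} (s≤s (s≤s y≤x)) = s≤s y≤x

pred⁺≤ : ∀ {x} → 1 ≤ x → pred⁺ x ≤ x
pred⁺≤ {suc zero} _ = ≤-refl
pred⁺≤ {suc (suc x)} _ = n≤1+n (suc x)

-- x² / (x − 1) = x + 1 + 1 / (x − 1) is non-decreasing for x ≥ 2.
sq/pred⁺-mono : ∀ {x y} → y ≤ x → (y * y) * pred⁺ x ≤ (x * x) * pred⁺ y
sq/pred⁺-mono {x} {zero} _ = z≤n
sq/pred⁺-mono {x} {suc zero} 1≤x = begin
  1 * pred⁺ x    ≡⟨ *-identityˡ _ ⟩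
  pred⁺ x        ≤⟨ pred⁺≤ 1≤x ⟩
  x              ≤⟨ m≤m*n x x {{>-nonZero 1≤x}} ⟩
  x * x          ≡⟨ *-identityʳ _ ⟨
  (x * x) * 1    ∎
  where open ≤-Reasoning
sq/pred⁺-mono {suc (suc x)} {suc (suc y)} (s≤s (s≤s y≤x)) with d , refl ← m≤n⇒∃[o]m+o≡n y≤x = begin
  (2 + y) * (2 + y) * suc (y + d)                                   ≤⟨ m≤m+n _ _ ⟩
  (2 + y) * (2 + y) * suc (y + d) + d * ((2 + y) * y + d * suc y)   ≡⟨ expand y d ⟨
  (2 + (y + d)) * (2 + (y + d)) * suc y                             ∎
  where
  open ≤-Reasoning
  expand : ∀ y d → (2 + (y + d)) * (2 + (y + d)) * suc y
                 ≡ (2 + y) * (2 + y) * suc (y + d) + d * ((2 + y) * y + d * suc y)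
  expand = solve-∀

factPredProd-mono : ∀ {as bs} → NonIncreasing bs → as ≻ bs → factPredProd bs ≤ factPredProd as
factPredProd-mono {as} {bs} nbs maj = begin
  factPredProd bs              ≡⟨ factPredProd≡Π-cells bs ⟩
  Π pred⁺ (cells bs)           ≡⟨ Π-↭ pred⁺ (sortedCells-↭ bs) ⟨
  Π pred⁺ (sortedCells bs)     ≤⟨ Π-mono-dominates pred⁺ pred⁺-mono (λ {x} _ → 1≤pred⁺ x)
                                    (sortedCells-sorted as) (sortedCells-sorted bs)
                                    (sortedCells-positive as) (≻⇒sortedCells-dominate nbs maj) ⟩
  Π pred⁺ (sortedCells as)     ≡⟨ Π-↭ pred⁺ (sortedCells-↭ as) ⟩
  Π pred⁺ (cells as)           ≡⟨ factPredProd≡Π-cells as ⟨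
  factPredProd as              ∎
  where open ≤-Reasoning

factProd²-cross : ∀ {as bs} → NonIncreasing bs → as ≻ bs →
                  (factProd bs * factProd bs) * factPredProd as ≤ (factProd as * factProd as) * factPredProd bs
factProd²-cross {as} {bs} nbs maj = subst₂ _≤_ (side bs as) (side as bs)
  (Π-ratio-mono sq pred⁺ sq/pred⁺-mono (λ 1≤x → ≤-trans (pred⁺≤ 1≤x) (m≤m*n _ _ {{>-nonZero 1≤x}}))
    (sortedCells-sorted as) (sortedCells-sorted bs) (sortedCells-positive as) (≻⇒sortedCells-dominate nbs maj))
  where
  sq : ℕ → ℕ
  sq x = x * x
  side : ∀ xs ys → Π sq (sortedCells xs) * Π pred⁺ (sortedCells ys) ≡ (factProd xs * factProd xs) * factPredProd ys
  side xs ys = begin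
    Π sq (sortedCells xs) * Π pred⁺ (sortedCells ys)
      ≡⟨ cong₂ _*_ (Π-↭ sq (sortedCells-↭ xs)) (Π-↭ pred⁺ (sortedCells-↭ ys)) ⟩
    Π sq (cells xs) * Π pred⁺ (cells ys)
      ≡⟨ cong₂ _*_ (Π-* id id (cells xs)) (sym (factPredProd≡Π-cells ys)) ⟩
    (Π id (cells xs) * Π id (cells xs)) * factPredProd ys
      ≡⟨ cong (λ z → (z * z) * factPredProd ys) (factProd≡Π-cells xs) ⟨
    (factProd xs * factProd xs) * factPredProd ys
      ∎
    where open ≡-Reasoning

product*factProd-mono : ∀ {as bs} → NonIncreasing bs → Positive as → Positive bs → as ≻ bs →
                        product bs * factProd bs ≤ product as * factProd as
product*factProd-mono {as} {bs} nbs pas pbs maj =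
  *-cancelʳ-≤ (Q * B) (P * A) (a * b) {{>-nonZero (*-mono-≤ (1≤factPredProd as) (1≤factPredProd bs))}} (begin
    (Q * B) * (a * b)  ≡⟨ regroupʳ Q B a b ⟩
    (B * (Q * b)) * a  ≡⟨ cong (λ z → (B * z) * a) (factProd≡product*factPredProd pbs) ⟨
    (B * B) * a        ≤⟨ factProd²-cross nbs maj ⟩
    (A * A) * b        ≡⟨ cong (λ z → (A * z) * b) (factProd≡product*factPredProd pas) ⟩
    (A * (P * a)) * b  ≡⟨ regroupˡ P A a b ⟩
    (P * A) * (a * b)  ∎)
  where
  open ≤-Reasoning
  P Q A B a b : ℕ
  P = product as
  Q = product bs
  A = factProd as
  B = factProd bs
  a = factPredProd as
  b = factPredProd bs
  regroupʳ : ∀ Q B a b → (Q * B) * (a * b) ≡ (B * (Q * b)) * a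
  regroupʳ = solve-∀
  regroupˡ : ∀ P A a b → (A * (P * a)) * b ≡ (P * A) * (a * b)
  regroupˡ = solve-∀

≻-head : ∀ {x as y bs} → (x ∷ as) ≻ (y ∷ bs) → y ≤ x
≻-head (_ , prefix , _) = subst₂ _≤_ (+-identityʳ _) (+-identityʳ _) (prefix 1 (s≤s z≤n))

≻-tail : ∀ {x as bs} → (x ∷ as) ≻ (x ∷ bs) → as ≻ bs
≻-tail {x} (length≤ , prefix , total) =
  s≤s⁻¹ length≤ , (λ i i≤n → +-cancelˡ-≤ x _ _ (prefix (suc i) (s≤s i≤n))) , +-cancelˡ-≤ x _ _ total

-- The cell x of the first row of as has no counterpart among the cells of bs.
≻-head<⇒factProd< : ∀ {x as y bs} → NonIncreasing (y ∷ bs) → Positive (y ∷ bs) → (x ∷ as) ≻ (y ∷ bs) → y < x →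
                    factProd (y ∷ bs) < factProd (x ∷ as)
≻-head<⇒factProd< {suc x} {as} {y} {bs} nbs (1≤y ∷ _) maj (s≤s y≤x) = begin-strict
  factProd (y ∷ bs)               ≡⟨ factProd≡Π-cells (y ∷ bs) ⟩
  Π id (cells (y ∷ bs))           ≡⟨ Π-↭ id (sortedCells-↭ (y ∷ bs)) ⟨
  Π id (sortedCells (y ∷ bs))     <⟨ Π-id-dominates-strict (sortedCells-sorted (suc x ∷ as)) (sortedCells-sorted (y ∷ bs))
                                       (sortedCells-positive (suc x ∷ as)) (≻⇒sortedCells-dominate nbs maj)
                                       (s≤s (≤-trans 1≤y y≤x)) x∈as x∉bs ⟩
  Π id (sortedCells (suc x ∷ as)) ≡⟨ Π-↭ id (sortedCells-↭ (suc x ∷ as)) ⟩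
  Π id (cells (suc x ∷ as))       ≡⟨ factProd≡Π-cells (suc x ∷ as) ⟨
  factProd (suc x ∷ as)           ∎
  where
  open ≤-Reasoning
  x∈as : 0 < count≥ (suc x) (sortedCells (suc x ∷ as))
  x∈as = begin-strict
    0                                        <⟨ m<n⇒0<n∸m (n<1+n x) ⟩
    suc x ∸ x                                ≤⟨ m≤m+n _ _ ⟩
    excess x (suc x ∷ as)                    ≡⟨ count≥-cells (suc x) (suc x ∷ as) ⟨
    count≥ (suc x) (cells (suc x ∷ as))      ≡⟨ count≥-↭ (suc x) (sortedCells-↭ (suc x ∷ as)) ⟨
    count≥ (suc x) (sortedCells (suc x ∷ as)) ∎
  x∉bs : count≥ (suc x) (sortedCells (y ∷ bs)) ≡ 0
  x∉bs = trans (count≥-↭ (suc x) (sortedCells-↭ (y ∷ bs)))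
           (trans (count≥-cells (suc x) (y ∷ bs)) (excess-bounded (bounded-by-head y≤x nbs)))

≻⇒≡⊎factProd< : ∀ {as bs} → NonIncreasing bs → Positive bs → as ≻ bs → as ≡ bs ⊎ factProd bs < factProd as
≻⇒≡⊎factProd< {[]} {[]} _ _ _ = inj₁ refl
≻⇒≡⊎factProd< {[]} {y ∷ bs} _ (1≤y ∷ _) (_ , _ , total) with () ← ≤-trans 1≤y (≤-trans (m≤m+n y (sum bs)) total)
≻⇒≡⊎factProd< {x ∷ as} {[]} _ _ (() , _)
≻⇒≡⊎factProd< {x ∷ as} {y ∷ bs} nbs pbs@(_ ∷ pbs′) maj with m≤n⇒m<n∨m≡n (≻-head maj)
... | inj₁ y<x = inj₂ (≻-head<⇒factProd< nbs pbs maj y<x)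
... | inj₂ refl with ≻⇒≡⊎factProd< (Linked.tail nbs) pbs′ (≻-tail maj)
...   | inj₁ refl = inj₁ refl
...   | inj₂ B<A = inj₂ (*-monoʳ-< (x !) {{x !≢0}} B<A)

-- With d = A − B = Q − P, Q · B − P · A = d · (B − P) > 0 since P < Q ≤ B.
+≡+⇒*<* : ∀ {A B P Q} → B < A → Q ≤ B → A + P ≡ B + Q → P * A < Q * B
+≡+⇒*<* {A} {B} {P} {Q} B<A Q≤B eq with d , refl ← m≤n⇒∃[o]m+o≡n B<A = begin-strict
  P * (suc B + d)         ≡⟨ expandˡ P B d ⟩
  P * B + suc d * P       <⟨ +-monoʳ-< (P * B) (*-monoʳ-< (suc d) P<B) ⟩
  P * B + suc d * B       ≡⟨ expandʳ P B d ⟩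
  suc (d + P) * B         ≡⟨ cong (_* B) Q≡ ⟨
  Q * B                   ∎
  where
  open ≤-Reasoning
  shift : ∀ B d P → suc B + d + P ≡ B + suc (d + P)
  shift = solve-∀
  expandˡ : ∀ P B d → P * (suc B + d) ≡ P * B + suc d * P
  expandˡ = solve-∀
  expandʳ : ∀ P B d → P * B + suc d * B ≡ suc (d + P) * B
  expandʳ = solve-∀
  Q≡ : Q ≡ suc (d + P)
  Q≡ = +-cancelˡ-≡ B Q (suc (d + P)) (trans (sym eq) (shift B d P))
  P<B : P < B
  P<B = <-≤-trans (s≤s (m≤n+m P d)) (subst (_≤ B) Q≡ Q≤B)

+≡+⇒<ʳ : ∀ {A B P Q} → A + Q ≡ B + P → B < A → Q < P
+≡+⇒<ʳ {A} {B} {P} {Q} eq B<A with Q <? P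
... | yes Q<P = Q<P
... | no Q≮P = contradiction (+-cancelʳ-≤ Q A B (begin
  A + Q  ≡⟨ eq ⟩
  B + P  ≤⟨ +-monoʳ-≤ B (≮⇒≥ Q≮P) ⟩
  B + Q  ∎)) (<⇒≱ B<A)
  where open ≤-Reasoning

-- (P − Q) · a ≤ P · a − Q · b = P − Q.
cofactor≤1 : ∀ {P Q a b} → b ≤ a → Q * b < P * a → P * a + Q ≡ Q * b + P → a ≤ 1
cofactor≤1 {P} {Q} {a} {b} b≤a Qb<Pa eq with e , refl ← m≤n⇒∃[o]m+o≡n (+≡+⇒<ʳ eq Qb<Pa) =
  *-cancelˡ-≤ (suc e) (+-cancelˡ-≤ (Q * a + Q) _ _ (begin
    (Q * a + Q) + suc e * a  ≡⟨ expandˡ Q e a ⟩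
    (suc Q + e) * a + Q      ≡⟨ eq ⟩
    Q * b + (suc Q + e)      ≤⟨ +-monoˡ-≤ (suc Q + e) (*-monoʳ-≤ Q b≤a) ⟩
    Q * a + (suc Q + e)      ≡⟨ expandʳ Q e a ⟩
    (Q * a + Q) + suc e * 1  ∎))
  where
  open ≤-Reasoning
  expandˡ : ∀ Q e a → (Q * a + Q) + suc e * a ≡ (suc Q + e) * a + Q
  expandˡ = solve-∀
  expandʳ : ∀ Q e a → Q * a + (suc Q + e) ≡ (Q * a + Q) + suc e * 1
  expandʳ = solve-∀

fact-pred≤1⇒≤2 : ∀ x → (x ∸ 1) ! ≤ 1 → x ≤ 2
fact-pred≤1⇒≤2 zero _ = z≤n
fact-pred≤1⇒≤2 (suc zero) _ = s≤s z≤n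
fact-pred≤1⇒≤2 (suc (suc zero)) _ = ≤-refl
fact-pred≤1⇒≤2 (suc (suc (suc x))) le with s≤s () ← ≤-trans (m≤m*n (suc (suc x)) (suc x !) {{suc x !≢0}}) le

factPredProd≤1⇒≤2 : ∀ xs → factPredProd xs ≤ 1 → All (_≤ 2) xs
factPredProd≤1⇒≤2 [] _ = []
factPredProd≤1⇒≤2 (x ∷ xs) le =
  fact-pred≤1⇒≤2 x (≤-trans (m≤m*n _ _ {{>-nonZero (1≤factPredProd xs)}}) le)
  ∷ factPredProd≤1⇒≤2 xs (≤-trans (m≤n*m _ _ {{(x ∸ 1) !≢0}}) le)

-≡-⇒+≡+ : ∀ a p b q → + a - + p ≡ + b - + q → a + q ≡ b + p
-≡-⇒+≡+ a p b q eq = ℤ.+-injective (begin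
  + (a + q)                   ≡⟨ ℤ.pos-+ a q ⟩
  + a ℤ.+ + q                 ≡⟨ regroup (+ a) (+ p) (+ q) ⟩
  (+ a - + p) ℤ.+ (+ p ℤ.+ + q) ≡⟨ cong (ℤ._+ (+ p ℤ.+ + q)) eq ⟩
  (+ b - + q) ℤ.+ (+ p ℤ.+ + q) ≡⟨ regroup′ (+ b) (+ p) (+ q) ⟩
  + b ℤ.+ + p                 ≡⟨ ℤ.pos-+ b p ⟨
  + (b + p)                   ∎)
  where
  open ≡-Reasoning
  regroup : ∀ a p q → a ℤ.+ q ≡ (a - p) ℤ.+ (p ℤ.+ q)
  regroup = ℤ-solve-∀
  regroup′ : ∀ b p q → (b - q) ℤ.+ (p ℤ.+ q) ≡ b ℤ.+ p
  regroup′ = ℤ-solve-∀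

product≤factProd : ∀ {xs} → Positive xs → product xs ≤ factProd xs
product≤factProd {xs} pxs = begin
  product xs                      ≤⟨ m≤m*n _ _ {{>-nonZero (1≤factPredProd xs)}} ⟩
  product xs * factPredProd xs    ≡⟨ factProd≡product*factPredProd pxs ⟨
  factProd xs                     ∎
  where open ≤-Reasoning

theorem2p2 : (as bs : List ℕ) → NonIncreasing as → NonIncreasing bs →
    Positive as → Positive bs → as ≻ bs →
    ((factProd as Data.Nat.+ product as ≡ factProd bs Data.Nat.+ product bs) → as ≡ bs)
    × (((+ factProd as) - (+ product as) ≡ (+ factProd bs) - (+ product bs)) →
        as ≡ bs ⊎ (All (_≤ 2) as × All (_≤ 2) bs))
theorem2p2 as bs _ nbs pas pbs maj = part-i , part-ii
  where
  A≡Pa : factProd as ≡ product as * factPredProd as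
  A≡Pa = factProd≡product*factPredProd pas
  B≡Qb : factProd bs ≡ product bs * factPredProd bs
  B≡Qb = factProd≡product*factPredProd pbs
  b≤a : factPredProd bs ≤ factPredProd as
  b≤a = factPredProd-mono nbs maj

  part-i : factProd as + product as ≡ factProd bs + product bs → as ≡ bs
  part-i eq with ≻⇒≡⊎factProd< nbs pbs maj
  ... | inj₁ as≡bs = as≡bs
  ... | inj₂ B<A = contradiction (product*factProd-mono nbs pas pbs maj)
                                 (<⇒≱ (+≡+⇒*<* B<A (product≤factProd pbs) eq))

  part-ii : + factProd as - + product as ≡ + factProd bs - + product bs →
            as ≡ bs ⊎ (All (_≤ 2) as × All (_≤ 2) bs)
  part-ii eq with ≻⇒≡⊎factProd< nbs pbs maj
  ... | inj₁ as≡bs = inj₁ as≡bs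
  ... | inj₂ B<A = inj₂ (factPredProd≤1⇒≤2 as a≤1 , factPredProd≤1⇒≤2 bs (≤-trans b≤a a≤1))
    where
    a≤1 : factPredProd as ≤ 1
    a≤1 = cofactor≤1 {product as} {product bs} b≤a (subst₂ _<_ B≡Qb A≡Pa B<A)
            (subst₂ (λ A B → A + product bs ≡ B + product as) A≡Pa B≡Qb
              (-≡-⇒+≡+ (factProd as) (product as) (factProd bs) (product bs) eq))
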